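{- For every integer $n\geq 0$, \[ p_2(n)=p\bigl(\tfrac{n}{2}\bigr)+\sum_{k\in\mathbb{Z}\smallsetminus\{0\}}(-1)^{k-1}\, p_2\bigl(n-k^2\bigr). \]
   Context: For a nonnegative integer $m$, $p(m)$ denotes the number of partitions of $m$ and $p_2(m)$ denotes the number of bipartitions of $m$, i.e. ordered pairs $(\lambda,\mu)$ of partitions with $|\lambda|+|\mu|=m$. By convention $p(0)=p_2(0)=1$, and $p(x)=p_2(x)=0$ whenever $x$ is not a nonnegative integer (so e.g. $p(n/2)=0$ for $n$ odd, and $p_2(n-k^2)=0$ for $k^2>n$). -}

module Defs where

open import Data.Nat using (ℕ; zero; suc; _≤_; _<_)
open import Data.Nat.DivMod using (_/_; _%_)
open import Data.Integer using (ℤ; +_; -_; _-_; _*_; _+_; ∣_∣)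
import Data.Integer as ℤ
open import Data.List using (List; []; _∷_; map; upTo; concatMap)
open import Data.Nat.ListAction using (sum)
open import Data.List.Relation.Unary.All using (All)
open import Data.List.Relation.Unary.Linked using (Linked)
open import Data.Product using (Σ; _×_)
open import Relation.Binary.PropositionalEquality using (_≡_)

record Partition (m : ℕ) : Set where
  constructor mkPartition
  field
    parts       : List ℕ
    positive    : All (0 <_) parts
    nonIncrease : Linked (λ a b → b ≤ a) parts
    sumParts    : sum parts ≡ m

Bipartition : ℕ → Set
Bipartition m = Σ ℕ λ a → Σ ℕ λ b → Partition a × Partition b × (a Data.Nat.+ b ≡ m)

extℤ : (ℕ → ℕ) → ℤ → ℤ
extℤ f (+ m)      = + f m
extℤ f ℤ.-[1+ _ ] = + 0

halfTerm : (ℕ → ℕ) → ℕ → ℤ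
halfTerm f n with n % 2
... | zero  = + f (n / 2)
... | suc _ = + 0

-- (-1)^(k-1) for k ∈ ℤ  (depends only on the parity of k = parity of |k|)
sgn : ℤ → ℤ
sgn k with ∣ k ∣ % 2
... | zero  = - (+ 1)
... | suc _ = + 1

-- The nonzero integers k with |k| ≤ n, i.e. k ∈ {±1, …, ±n}.
-- For |k| > n we have k² > n, so p₂(n - k²) = 0 and those terms vanish.
nonzeroRange : ℕ → List ℤ
nonzeroRange n = concatMap (λ j → + suc j ∷ - (+ suc j) ∷ []) (upTo n)

altSum : (ℕ → ℕ) → ℕ → ℤ
altSum p₂ n = sum' (map (λ k → sgn k * extℤ p₂ (+ n - k * k)) (nonzeroRange n))
  where
  sum' : List ℤ → ℤ
  sum' []       = + 0
  sum' (x ∷ xs) = x + sum' xs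

{-# OPTIONS --safe #-}
module Submission where

-- Let F_K = 1/(q;q)_K, the generating function of partitions with parts ≤ K. For every n,
--   Σ_(|j| ≤ n) (-1)^j q^(j²) F_(n+j) F_(n-j) = 1/(q²;q²)_n.
-- At n = 0 both sides are 1. Multiplying the n-th instance by 1 - q^(2n) gives the (n-1)-st: on the right
-- by substituting q ↦ q² in (1 - q^n) F_n = F_(n-1), on the left because with a = n + j, b = n - j the identity
--   (1 - q^(a+b)) - (1 - q^a)(1 - q^b) = q^b (1 - q^a) + q^a (1 - q^b)
-- turns the difference of the j-th terms into a telescoping sum over j. As q^m with m ≤ n only sees parts
-- ≤ n, the coefficient of q^n is p₂(n) + 2 Σ_(j ≥ 1) (-1)^j p₂(n - j²) on the left and p(n/2) on the right.

open import Defs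
open import Data.Nat using (ℕ)
open import Data.Fin using (Fin)
open import Data.Integer using (ℤ; +_; _+_)
open import Function.Bundles using (_↔_)
open import Relation.Binary.PropositionalEquality using (_≡_)

open import Data.Nat as ℕ using (zero; suc; _≤_; _<_; z≤n; s≤s)
import Data.Nat.Properties as ℕₚ
open import Data.Nat.DivMod using (m/n≡1+[m∸n]/n)
open import Data.Nat.Induction using (<-rec)
open import Data.Nat.ListAction using (sum)
import Data.Nat.Tactic.RingSolver as ℕ-Solver
open import Data.Integer using (_-_; -_; _*_)
import Data.Integer.Properties as ℤₚ
open import Data.Integer.Tactic.RingSolver using (solve-∀)
open import Data.List using ([]; _∷_; map; foldr; concatMap; applyUpTo)
open import Data.List.Properties using (foldr-universal)
open import Data.List.Relation.Unary.All as All using (All; []; _∷_)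
open import Data.List.Relation.Unary.Linked as Linked using (Linked; []; [-]; _∷_)
open import Data.Product using (Σ-syntax; _×_; _,_; proj₁)
open import Data.Sum using (_⊎_; inj₁; inj₂)
open import Data.Empty using (⊥; ⊥-elim)
import Data.Fin as Fin
open import Data.Fin.Properties using (+↔⊎; *↔×; 0↔⊥)
open import Data.Fin.Permutation using (↔⇒≡)
open import Function.Base using (_∘_)
open import Function.Bundles using (mk↔ₛ′)
open import Function.Properties.Inverse using (↔-trans; ↔-sym)
open import Data.Sum.Function.Propositional using (_⊎-↔_)
open import Data.Product.Function.NonDependent.Propositional using (_×-↔_)
open import Relation.Binary.PropositionalEquality
  using (refl; sym; trans; cong; cong₂; _≗_; module ≡-Reasoning)
open import Relation.Nullary using (yes; no)

-- Formal power series

Series : Set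
Series = ℕ → ℤ

0ₛ 1ₛ : Series
0ₛ _       = + 0
1ₛ zero    = + 1
1ₛ (suc _) = + 0

infixl 6 _+ₛ_ _-ₛ_
infixl 7 _*ₛ_

_+ₛ_ _-ₛ_ : Series → Series → Series
(f +ₛ g) m = f m + g m
(f -ₛ g) m = f m - g m

_*ₛ_ : Series → Series → Series
(f *ₛ g) zero    = f 0 * g 0
(f *ₛ g) (suc m) = f 0 * g (suc m) + (f ∘ suc *ₛ g) m

shift : ℕ → Series → Series
shift zero    f m       = f m
shift (suc s) f zero    = + 0
shift (suc s) f (suc m) = shift s f m

1-q^_·_ : ℕ → Series → Series
1-q^ s · f = f -ₛ shift s f

shift-cong : ∀ s {f g} → f ≗ g → shift s f ≗ shift s g
shift-cong zero    f≗g m       = f≗g m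
shift-cong (suc s) f≗g zero    = refl
shift-cong (suc s) f≗g (suc m) = shift-cong s f≗g m

shift-zipWith : ∀ s (_∙_ : ℤ → ℤ → ℤ) → (+ 0) ∙ (+ 0) ≡ + 0 → ∀ f g →
                shift s (λ i → f i ∙ g i) ≗ λ m → shift s f m ∙ shift s g m
shift-zipWith zero    _∙_ 0∙0 f g m       = refl
shift-zipWith (suc s) _∙_ 0∙0 f g zero    = sym 0∙0
shift-zipWith (suc s) _∙_ 0∙0 f g (suc m) = shift-zipWith s _∙_ 0∙0 f g m

shift-map : ∀ s (φ : ℤ → ℤ) → φ (+ 0) ≡ + 0 → ∀ f → shift s (φ ∘ f) ≗ φ ∘ shift s f
shift-map zero    φ φ0 f m       = refl
shift-map (suc s) φ φ0 f zero    = sym φ0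
shift-map (suc s) φ φ0 f (suc m) = shift-map s φ φ0 f m

shift-sub : ∀ s f g → shift s (f -ₛ g) ≗ shift s f -ₛ shift s g
shift-sub s = shift-zipWith s _-_ refl

shift-shift : ∀ s t f → shift s (shift t f) ≗ shift (s ℕ.+ t) f
shift-shift zero    t f m       = refl
shift-shift (suc s) t f zero    = refl
shift-shift (suc s) t f (suc m) = shift-shift s t f m

shift-< : ∀ {s m} f → m < s → shift s f m ≡ + 0
shift-< {suc s} {zero}  f _         = refl
shift-< {suc s} {suc m} f (s≤s m<s) = shift-< f m<s

shift-≥ : ∀ {s m} f → s ≤ m → shift s f m ≡ f (m ℕ.∸ s)
shift-≥ {zero}            f _         = refl
shift-≥ {suc s} {suc m}   f (s≤s s≤m) = shift-≥ f s≤m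

shift-0ₛ : ∀ s → shift s 0ₛ ≗ 0ₛ
shift-0ₛ zero    m       = refl
shift-0ₛ (suc s) zero    = refl
shift-0ₛ (suc s) (suc m) = shift-0ₛ s m

1-q^-cong : ∀ s {f g} → f ≗ g → 1-q^ s · f ≗ 1-q^ s · g
1-q^-cong s f≗g m = cong₂ _-_ (f≗g m) (shift-cong s f≗g m)

shift-1-q^-expand : ∀ t s f m → shift t (1-q^ s · f) m ≡ shift t f m - shift (t ℕ.+ s) f m
shift-1-q^-expand t s f m = trans (shift-sub t f (shift s f) m) (cong (_-_ (shift t f m)) (shift-shift t s f m))

shift-1-q^ : ∀ t s f → shift t (1-q^ s · f) ≗ 1-q^ s · shift t f
shift-1-q^ t s f m = begin
  shift t (1-q^ s · f) m                   ≡⟨ shift-1-q^-expand t s f m ⟩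
  shift t f m - shift (t ℕ.+ s) f m        ≡⟨ cong (λ e → shift t f m - shift e f m) (ℕₚ.+-comm t s) ⟩
  shift t f m - shift (s ℕ.+ t) f m        ≡⟨ cong (_-_ (shift t f m)) (shift-shift s t f m) ⟨
  shift t f m - shift s (shift t f) m      ∎
  where open ≡-Reasoning

1-q^-+ : ∀ a b f → 1-q^ (a ℕ.+ b) · f -ₛ 1-q^ a · (1-q^ b · f) ≗ shift b (1-q^ a · f) +ₛ shift a (1-q^ b · f)
1-q^-+ a b f m = begin
  (f m - shift (a ℕ.+ b) f m) - ((f m - shift b f m) - shift a (1-q^ b · f) m)
    ≡⟨ cong (λ x → (f m - shift (a ℕ.+ b) f m) - ((f m - shift b f m) - x)) (shift-1-q^-expand a b f m) ⟩
  (f m - shift (a ℕ.+ b) f m) - ((f m - shift b f m) - (shift a f m - shift (a ℕ.+ b) f m))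
    ≡⟨ regroup (f m) (shift a f m) (shift b f m) (shift (a ℕ.+ b) f m) ⟩
  (shift b f m - shift (a ℕ.+ b) f m) + (shift a f m - shift (a ℕ.+ b) f m)
    ≡⟨ cong (λ e → (shift b f m - shift e f m) + (shift a f m - shift (a ℕ.+ b) f m)) (ℕₚ.+-comm a b) ⟩
  (shift b f m - shift (b ℕ.+ a) f m) + (shift a f m - shift (a ℕ.+ b) f m)
    ≡⟨ cong₂ _+_ (shift-1-q^-expand b a f m) (shift-1-q^-expand a b f m) ⟨
  shift b (1-q^ a · f) m + shift a (1-q^ b · f) m
    ∎
  where
  open ≡-Reasoning
  regroup : ∀ x A B AB → (x - AB) - ((x - B) - (A - AB)) ≡ (B - AB) + (A - AB)
  regroup = solve-∀

shift-cong-< : ∀ s {f g} m → (∀ {r} → r < m → f r ≡ g r) → shift (suc s) f m ≡ shift (suc s) g m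
shift-cong-< s       zero    f≡g = refl
shift-cong-< zero    (suc m) f≡g = f≡g (ℕₚ.n<1+n m)
shift-cong-< (suc s) (suc m) f≡g = shift-cong-< s m (f≡g ∘ ℕₚ.m<n⇒m<1+n)

1-q^-cancel : ∀ s {f g} → 1-q^ suc s · f ≗ 1-q^ suc s · g → f ≗ g
1-q^-cancel s {f} {g} eq = <-rec (λ m → f m ≡ g m) step
  where
  unsplit : ∀ x y → x ≡ (x - y) + y
  unsplit = solve-∀
  step : ∀ m → (∀ {r} → r < m → f r ≡ g r) → f m ≡ g m
  step m f≡g = begin
    f m                                          ≡⟨ unsplit (f m) _ ⟩
    (1-q^ suc s · f) m + shift (suc s) f m       ≡⟨ cong₂ _+_ (eq m) (shift-cong-< s m f≡g) ⟩
    (1-q^ suc s · g) m + shift (suc s) g m       ≡⟨ unsplit (g m) _ ⟨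
    g m                                          ∎
    where open ≡-Reasoning

*ₛ-cong-≤ : ∀ m {f f′ g g′} → (∀ {i} → i ≤ m → f i ≡ f′ i) → (∀ {i} → i ≤ m → g i ≡ g′ i) →
            (f *ₛ g) m ≡ (f′ *ₛ g′) m
*ₛ-cong-≤ zero    f≡ g≡ = cong₂ _*_ (f≡ z≤n) (g≡ z≤n)
*ₛ-cong-≤ (suc m) f≡ g≡ =
  cong₂ _+_ (cong₂ _*_ (f≡ z≤n) (g≡ ℕₚ.≤-refl)) (*ₛ-cong-≤ m (f≡ ∘ s≤s) (g≡ ∘ ℕₚ.m≤n⇒m≤1+n))

*ₛ-cong : ∀ {f f′ g g′} → f ≗ f′ → g ≗ g′ → f *ₛ g ≗ f′ *ₛ g′
*ₛ-cong f≗ g≗ m = *ₛ-cong-≤ m (λ {i} _ → f≗ i) (λ {i} _ → g≗ i)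

*ₛ-zeroˡ : ∀ f g → f ≗ 0ₛ → f *ₛ g ≗ 0ₛ
*ₛ-zeroˡ f g f≗0 zero    = trans (cong (_* g 0) (f≗0 0)) (ℤₚ.*-zeroˡ (g 0))
*ₛ-zeroˡ f g f≗0 (suc m) =
  cong₂ _+_ (trans (cong (_* g (suc m)) (f≗0 0)) (ℤₚ.*-zeroˡ (g (suc m)))) (*ₛ-zeroˡ (f ∘ suc) g (f≗0 ∘ suc) m)

*ₛ-suc : ∀ f g m → (f *ₛ g) (suc m) ≡ (f *ₛ g ∘ suc) m + f (suc m) * g 0
*ₛ-suc f g zero    = refl
*ₛ-suc f g (suc m) = begin
  f 0 * g (suc (suc m)) + (f ∘ suc *ₛ g) (suc m)
    ≡⟨ cong (_+_ (f 0 * g (suc (suc m)))) (*ₛ-suc (f ∘ suc) g m) ⟩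
  f 0 * g (suc (suc m)) + ((f ∘ suc *ₛ g ∘ suc) m + f (suc (suc m)) * g 0)
    ≡⟨ ℤₚ.+-assoc (f 0 * g (suc (suc m))) _ _ ⟨
  (f *ₛ g ∘ suc) (suc m) + f (suc (suc m)) * g 0
    ∎
  where open ≡-Reasoning

*ₛ-comm : ∀ f g → f *ₛ g ≗ g *ₛ f
*ₛ-comm f g zero    = ℤₚ.*-comm (f 0) (g 0)
*ₛ-comm f g (suc m) = begin
  f 0 * g (suc m) + (f ∘ suc *ₛ g) m   ≡⟨ cong₂ _+_ (ℤₚ.*-comm (f 0) (g (suc m))) (*ₛ-comm (f ∘ suc) g m) ⟩
  g (suc m) * f 0 + (g *ₛ f ∘ suc) m   ≡⟨ ℤₚ.+-comm (g (suc m) * f 0) _ ⟩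
  (g *ₛ f ∘ suc) m + g (suc m) * f 0   ≡⟨ *ₛ-suc g f m ⟨
  (g *ₛ f) (suc m)                     ∎
  where open ≡-Reasoning

*ₛ-zeroʳ : ∀ f g → g ≗ 0ₛ → f *ₛ g ≗ 0ₛ
*ₛ-zeroʳ f g g≗0 m = trans (*ₛ-comm f g m) (*ₛ-zeroˡ g f g≗0 m)

*ₛ-identityˡ : ∀ f → 1ₛ *ₛ f ≗ f
*ₛ-identityˡ f zero    = ℤₚ.*-identityˡ (f 0)
*ₛ-identityˡ f (suc m) = begin
  + 1 * f (suc m) + (0ₛ *ₛ f) m   ≡⟨ cong₂ _+_ (ℤₚ.*-identityˡ (f (suc m))) (*ₛ-zeroˡ 0ₛ f (λ _ → refl) m) ⟩
  f (suc m) + + 0                 ≡⟨ ℤₚ.+-identityʳ (f (suc m)) ⟩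
  f (suc m)                       ∎
  where open ≡-Reasoning

*ₛ-distribʳ-sub : ∀ f g h → (f -ₛ g) *ₛ h ≗ f *ₛ h -ₛ g *ₛ h
*ₛ-distribʳ-sub f g h zero    = distrib (f 0) (g 0) (h 0)
  where
  distrib : ∀ a b c → (a - b) * c ≡ a * c - b * c
  distrib = solve-∀
*ₛ-distribʳ-sub f g h (suc m) = begin
  (f 0 - g 0) * h (suc m) + ((f ∘ suc -ₛ g ∘ suc) *ₛ h) m
    ≡⟨ cong (_+_ ((f 0 - g 0) * h (suc m))) (*ₛ-distribʳ-sub (f ∘ suc) (g ∘ suc) h m) ⟩
  (f 0 - g 0) * h (suc m) + ((f ∘ suc *ₛ h) m - (g ∘ suc *ₛ h) m)
    ≡⟨ regroup (f 0) (g 0) (h (suc m)) _ _ ⟩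
  (f *ₛ h) (suc m) - (g *ₛ h) (suc m)
    ∎
  where
  open ≡-Reasoning
  regroup : ∀ a b c x y → (a - b) * c + (x - y) ≡ (a * c + x) - (b * c + y)
  regroup = solve-∀

*ₛ-distribˡ-sub : ∀ f g h → h *ₛ (f -ₛ g) ≗ h *ₛ f -ₛ h *ₛ g
*ₛ-distribˡ-sub f g h m = begin
  (h *ₛ (f -ₛ g)) m            ≡⟨ *ₛ-comm h (f -ₛ g) m ⟩
  ((f -ₛ g) *ₛ h) m            ≡⟨ *ₛ-distribʳ-sub f g h m ⟩
  (f *ₛ h) m - (g *ₛ h) m      ≡⟨ cong₂ _-_ (*ₛ-comm f h m) (*ₛ-comm g h m) ⟩
  (h *ₛ f) m - (h *ₛ g) m      ∎
  where open ≡-Reasoning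

shift-*ₛˡ : ∀ s f g → shift s f *ₛ g ≗ shift s (f *ₛ g)
shift-*ₛˡ zero    f g m       = refl
shift-*ₛˡ (suc s) f g zero    = refl
shift-*ₛˡ (suc s) f g (suc m) = trans (ℤₚ.+-identityˡ _) (shift-*ₛˡ s f g m)

shift-*ₛʳ : ∀ s f g → f *ₛ shift s g ≗ shift s (f *ₛ g)
shift-*ₛʳ s f g m = begin
  (f *ₛ shift s g) m    ≡⟨ *ₛ-comm f (shift s g) m ⟩
  (shift s g *ₛ f) m    ≡⟨ shift-*ₛˡ s g f m ⟩
  shift s (g *ₛ f) m    ≡⟨ shift-cong s (*ₛ-comm g f) m ⟩
  shift s (f *ₛ g) m    ∎
  where open ≡-Reasoning

1-q^-*ₛˡ : ∀ s f g → (1-q^ s · f) *ₛ g ≗ 1-q^ s · (f *ₛ g)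
1-q^-*ₛˡ s f g m = trans (*ₛ-distribʳ-sub f (shift s f) g m) (cong (_-_ ((f *ₛ g) m)) (shift-*ₛˡ s f g m))

1-q^-*ₛʳ : ∀ s f g → f *ₛ (1-q^ s · g) ≗ 1-q^ s · (f *ₛ g)
1-q^-*ₛʳ s f g m = trans (*ₛ-distribˡ-sub g (shift s g) f m) (cong (_-_ ((f *ₛ g) m)) (shift-*ₛʳ s f g m))

∑< : ℕ → (ℕ → ℤ) → ℤ
∑< zero    g = + 0
∑< (suc n) g = ∑< n g + g n

syntax ∑< n (λ j → e) = ∑[ j < n ] e

∑<-cong : ∀ n {g h} → (∀ {j} → j < n → g j ≡ h j) → ∑< n g ≡ ∑< n h
∑<-cong zero    g≡h = refl
∑<-cong (suc n) g≡h = cong₂ _+_ (∑<-cong n (g≡h ∘ ℕₚ.m<n⇒m<1+n)) (g≡h (ℕₚ.n<1+n n))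

∑<-+ : ∀ n g h → ∑[ j < n ] (g j + h j) ≡ ∑< n g + ∑< n h
∑<-+ zero    g h = refl
∑<-+ (suc n) g h = trans (cong (_+ (g n + h n)) (∑<-+ n g h)) (swap (∑< n g) (∑< n h) (g n) (h n))
  where
  swap : ∀ a b c d → (a + b) + (c + d) ≡ (a + c) + (b + d)
  swap = solve-∀

∑<-cons : ∀ n g → ∑< (suc n) g ≡ g 0 + ∑[ j < n ] g (suc j)
∑<-cons zero    g = trans (ℤₚ.+-identityˡ (g 0)) (sym (ℤₚ.+-identityʳ (g 0)))
∑<-cons (suc n) g = trans (cong (_+ g (suc n)) (∑<-cons n g)) (ℤₚ.+-assoc (g 0) _ _)

∑<-neg : ∀ n g → ∑[ j < n ] (- g j) ≡ - ∑< n g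
∑<-neg zero    g = refl
∑<-neg (suc n) g = trans (cong (_+ - g n) (∑<-neg n g)) (sym (ℤₚ.neg-distrib-+ (∑< n g) (g n)))

1-q^-∑ : ∀ s n (c : ℕ → ℤ) (h : ℕ → Series) →
         1-q^ s · (λ i → ∑[ j < n ] (c j * h j i)) ≗ λ m → ∑[ j < n ] (c j * (1-q^ s · h j) m)
1-q^-∑ s zero    c h m = cong (_-_ (+ 0)) (shift-0ₛ s m)
1-q^-∑ s (suc n) c h m = begin
  (S m + c n * h n m) - shift s (λ i → S i + c n * h n i) m
    ≡⟨ cong (_-_ (S m + c n * h n m)) (shift-zipWith s _+_ refl S (λ i → c n * h n i) m) ⟩
  (S m + c n * h n m) - (shift s S m + shift s (λ i → c n * h n i) m)
    ≡⟨ cong (λ x → (S m + c n * h n m) - (shift s S m + x)) (shift-map s (c n *_) (ℤₚ.*-zeroʳ (c n)) (h n) m) ⟩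
  (S m + c n * h n m) - (shift s S m + c n * shift s (h n) m)
    ≡⟨ regroup (S m) (shift s S m) (c n) (h n m) (shift s (h n) m) ⟩
  (1-q^ s · S) m + c n * (1-q^ s · h n) m
    ≡⟨ cong (_+ c n * (1-q^ s · h n) m) (1-q^-∑ s n c h m) ⟩
  ∑[ j < suc n ] (c j * (1-q^ s · h j) m)
    ∎
  where
  open ≡-Reasoning
  S : Series
  S i = ∑[ j < n ] (c j * h j i)
  regroup : ∀ a b c x y → (a + c * x) - (b + c * y) ≡ (a - b) + c * (x - y)
  regroup = solve-∀

-- Substitution q ↦ q².
dilate : Series → Series
dilate f zero          = f 0
dilate f (suc zero)    = + 0
dilate f (suc (suc m)) = dilate (f ∘ suc) m

dilate-cong : ∀ {f g} → f ≗ g → dilate f ≗ dilate g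
dilate-cong f≗g zero          = f≗g 0
dilate-cong f≗g (suc zero)    = refl
dilate-cong f≗g (suc (suc m)) = dilate-cong (f≗g ∘ suc) m

dilate-0ₛ : dilate 0ₛ ≗ 0ₛ
dilate-0ₛ zero          = refl
dilate-0ₛ (suc zero)    = refl
dilate-0ₛ (suc (suc m)) = dilate-0ₛ m

dilate-1ₛ : dilate 1ₛ ≗ 1ₛ
dilate-1ₛ zero          = refl
dilate-1ₛ (suc zero)    = refl
dilate-1ₛ (suc (suc m)) = dilate-0ₛ m

dilate-sub : ∀ f g → dilate (f -ₛ g) ≗ dilate f -ₛ dilate g
dilate-sub f g zero          = refl
dilate-sub f g (suc zero)    = refl
dilate-sub f g (suc (suc m)) = dilate-sub (f ∘ suc) (g ∘ suc) m

shift-dilate : ∀ s f → shift (s ℕ.+ s) (dilate f) ≗ dilate (shift s f)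
shift-dilate zero    f m = refl
shift-dilate (suc s) f m = trans (cong (λ e → shift (suc e) (dilate f) m) (ℕₚ.+-suc s s)) (shift-2+-dilate m)
  where
  shift-2+-dilate : ∀ m → shift (2 ℕ.+ (s ℕ.+ s)) (dilate f) m ≡ dilate (shift (suc s) f) m
  shift-2+-dilate zero          = refl
  shift-2+-dilate (suc zero)    = refl
  shift-2+-dilate (suc (suc m)) = shift-dilate s f m

1-q^-dilate : ∀ s f → 1-q^ (s ℕ.+ s) · dilate f ≗ dilate (1-q^ s · f)
1-q^-dilate s f m = trans (cong (_-_ (dilate f m)) (shift-dilate s f m)) (sym (dilate-sub f (shift s f) m))

-- A finite theta identity

pairCount : ℕ → ℤ
pairCount zero    = + 1
pairCount (suc _) = + 2

-1^_ : ℕ → ℤ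
-1^ zero  = + 1
-1^ suc j = - (-1^ j)

telescope : ∀ (u : ℕ → ℤ) n → u 0 + u 1 ≡ + 0 →
            ∑[ j < suc n ] (pairCount j * (u j - u (suc j))) ≡ - (+ 2 * u (suc n))
telescope u zero    u₀+u₁≡0 = begin
  + 0 + + 1 * (u 0 - u 1)    ≡⟨ first (u 0) (u 1) ⟩
  (u 0 + u 1) - + 2 * u 1    ≡⟨ cong (_- + 2 * u 1) u₀+u₁≡0 ⟩
  + 0 - + 2 * u 1            ≡⟨ ℤₚ.+-identityˡ _ ⟩
  - (+ 2 * u 1)              ∎
  where
  open ≡-Reasoning
  first : ∀ a b → + 0 + + 1 * (a - b) ≡ (a + b) - + 2 * b
  first = solve-∀
telescope u (suc n) u₀+u₁≡0 =
  trans (cong (_+ + 2 * (u (suc n) - u (suc (suc n)))) (telescope u n u₀+u₁≡0)) (next (u (suc n)) (u (suc (suc n))))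
  where
  next : ∀ a b → - (+ 2 * a) + + 2 * (a - b) ≡ - (+ 2 * b)
  next = solve-∀

-- F K plays the role of 1/(q;q)_(K-1); F 0 = 0 is 1/(q;q)_(-1), which kills the boundary terms below.
module ThetaSum (F : ℕ → Series) (F-0 : F 0 ≗ 0ₛ) (F-1 : F 1 ≗ 1ₛ)
                (F-rec : ∀ K → 1-q^ K · F (suc K) ≗ F K) where

  T : ℕ → ℕ → Series
  T n j = shift (j ℕ.* j) (F (suc (n ℕ.+ j)) *ₛ F (suc n ℕ.∸ j))

  weight : ℕ → ℤ
  weight j = pairCount j * -1^ j

  thetaSum : ℕ → Series
  thetaSum n m = ∑[ j < suc n ] (weight j * T n j m)

  U : ℕ → ℕ → Series
  U n j m = -1^ j * shift (j ℕ.* j ℕ.+ suc n ℕ.∸ j) (F (suc n ℕ.+ j) *ₛ F (suc (suc n) ℕ.∸ j)) m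

  F-cong : ∀ {K L} → K ≡ L → F K ≗ F L
  F-cong refl i = refl

  boundary≗0ₛ : ∀ e G n → shift e (G *ₛ F (n ℕ.∸ n)) ≗ 0ₛ
  boundary≗0ₛ e G n m =
    trans (shift-cong e (*ₛ-zeroʳ G _ (λ i → trans (F-cong (ℕₚ.n∸n≡0 n) i) (F-0 i))) m) (shift-0ₛ e m)

  T-last : ∀ n → T n (suc n) ≗ 0ₛ
  T-last n = boundary≗0ₛ (suc n ℕ.* suc n) (F (suc (n ℕ.+ suc n))) n

  U-last : ∀ n m → U n (suc (suc n)) m ≡ + 0
  U-last n m =
    trans (cong (-1^ j *_) (boundary≗0ₛ (j ℕ.* j ℕ.+ suc n ℕ.∸ j) (F (suc n ℕ.+ j)) n m)) (ℤₚ.*-zeroʳ (-1^ j))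
    where
    j : ℕ
    j = suc (suc n)

  U-0+1 : ∀ n m → U n 0 m + U n 1 m ≡ + 0
  U-0+1 n m = begin
    + 1 * shift N (F (N ℕ.+ 0) *ₛ F (suc N)) m + - (+ 1) * shift N (F (N ℕ.+ 1) *ₛ F N) m
      ≡⟨ cong₂ (λ X Y → + 1 * X + - (+ 1) * Y)
           (shift-cong N (*ₛ-cong (F-cong (ℕₚ.+-identityʳ N)) (λ _ → refl)) m)
           (shift-cong N (λ i → trans (*ₛ-cong (F-cong (ℕₚ.+-comm N 1)) (λ _ → refl) i)
                                      (*ₛ-comm (F (suc N)) (F N) i)) m) ⟩
    + 1 * x + - (+ 1) * x
      ≡⟨ cancel x ⟩
    + 0 ∎
    where
    open ≡-Reasoning
    N : ℕ
    N = suc n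
    x : ℤ
    x = shift N (F N *ₛ F (suc N)) m
    cancel : ∀ x → + 1 * x + - (+ 1) * x ≡ + 0
    cancel = solve-∀

  module _ (n j : ℕ) (j≤N : j ≤ suc n) where
    private
      N a b jj : ℕ
      N  = suc n
      a  = N ℕ.+ j
      b  = N ℕ.∸ j
      jj = j ℕ.* j

      P : Series
      P = F (suc a) *ₛ F (suc b)

      F[N+1-j]≗F[b+1] : F (suc N ℕ.∸ j) ≗ F (suc b)
      F[N+1-j]≗F[b+1] = F-cong (ℕₚ.+-∸-assoc 1 j≤N)

      a+b≡N+N : a ℕ.+ b ≡ N ℕ.+ N
      a+b≡N+N = trans (ℕₚ.+-assoc N j b) (cong (N ℕ.+_) (ℕₚ.m+[n∸m]≡n j≤N))

      T-N : T N j ≗ shift jj P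
      T-N = shift-cong jj (*ₛ-cong (λ _ → refl) F[N+1-j]≗F[b+1])

      T-n : T n j ≗ shift jj (1-q^ a · (1-q^ b · P))
      T-n = shift-cong jj λ m → begin
        (F a *ₛ F b) m                                        ≡⟨ *ₛ-cong (sym ∘ F-rec a) (sym ∘ F-rec b) m ⟩
        ((1-q^ a · F (suc a)) *ₛ (1-q^ b · F (suc b))) m      ≡⟨ 1-q^-*ₛˡ a _ _ m ⟩
        (1-q^ a · (F (suc a) *ₛ (1-q^ b · F (suc b)))) m      ≡⟨ 1-q^-cong a (1-q^-*ₛʳ b _ _) m ⟩
        (1-q^ a · (1-q^ b · P)) m                             ∎
        where open ≡-Reasoning

      U-j : ∀ m → U n j m ≡ -1^ j * shift jj (shift b (1-q^ a · P)) m
      U-j m = cong (-1^ j *_) (begin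
        shift (jj ℕ.+ N ℕ.∸ j) (F a *ₛ F (suc N ℕ.∸ j)) m
          ≡⟨ cong (λ e → shift e (F a *ₛ F (suc N ℕ.∸ j)) m) (ℕₚ.+-∸-assoc jj j≤N) ⟩
        shift (jj ℕ.+ b) (F a *ₛ F (suc N ℕ.∸ j)) m
          ≡⟨ shift-cong (jj ℕ.+ b) (λ i → trans (*ₛ-cong (sym ∘ F-rec a) F[N+1-j]≗F[b+1] i) (1-q^-*ₛˡ a _ _ i)) m ⟩
        shift (jj ℕ.+ b) (1-q^ a · P) m
          ≡⟨ shift-shift jj b _ m ⟨
        shift jj (shift b (1-q^ a · P)) m
          ∎)
        where open ≡-Reasoning

      U-sj-exponent : suc j ℕ.* suc j ℕ.+ N ℕ.∸ suc j ≡ jj ℕ.+ a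
      U-sj-exponent = trans (cong (ℕ._∸ suc j) (expand j N)) (ℕₚ.m+n∸m≡n (suc j) (jj ℕ.+ a))
        where
        expand : ∀ j N → suc j ℕ.* suc j ℕ.+ N ≡ suc j ℕ.+ (j ℕ.* j ℕ.+ (N ℕ.+ j))
        expand = ℕ-Solver.solve-∀

      U-sj : ∀ m → U n (suc j) m ≡ - -1^ j * shift jj (shift a (1-q^ b · P)) m
      U-sj m = cong (- -1^ j *_) (begin
        shift (suc j ℕ.* suc j ℕ.+ N ℕ.∸ suc j) (F (N ℕ.+ suc j) *ₛ F b) m
          ≡⟨ cong (λ e → shift e (F (N ℕ.+ suc j) *ₛ F b) m) U-sj-exponent ⟩
        shift (jj ℕ.+ a) (F (N ℕ.+ suc j) *ₛ F b) m
          ≡⟨ shift-cong (jj ℕ.+ a)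
               (λ i → trans (*ₛ-cong (F-cong (ℕₚ.+-suc N j)) (sym ∘ F-rec b) i) (1-q^-*ₛʳ b _ _ i)) m ⟩
        shift (jj ℕ.+ a) (1-q^ b · P) m
          ≡⟨ shift-shift jj a _ m ⟨
        shift jj (shift a (1-q^ b · P)) m
          ∎)
        where open ≡-Reasoning

    T-step : ∀ m → -1^ j * ((1-q^ (N ℕ.+ N) · T N j) m - T n j m) ≡ U n j m - U n (suc j) m
    T-step m = begin
      -1^ j * ((1-q^ (N ℕ.+ N) · T N j) m - T n j m)
        ≡⟨ cong (-1^ j *_) (cong₂ _-_ (trans (1-q^-cong (N ℕ.+ N) T-N m) 1-q^[N+N]P) (T-n m)) ⟩
      -1^ j * (shift jj (1-q^ (a ℕ.+ b) · P) m - shift jj (1-q^ a · (1-q^ b · P)) m)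
        ≡⟨ cong (-1^ j *_) (shift-sub jj _ _ m) ⟨
      -1^ j * shift jj (1-q^ (a ℕ.+ b) · P -ₛ 1-q^ a · (1-q^ b · P)) m
        ≡⟨ cong (-1^ j *_) (trans (shift-cong jj (1-q^-+ a b P) m) (shift-zipWith jj _+_ refl _ _ m)) ⟩
      -1^ j * (shift jj (shift b (1-q^ a · P)) m + shift jj (shift a (1-q^ b · P)) m)
        ≡⟨ distribute (-1^ j) _ _ ⟩
      -1^ j * shift jj (shift b (1-q^ a · P)) m - - -1^ j * shift jj (shift a (1-q^ b · P)) m
        ≡⟨ cong₂ _-_ (U-j m) (U-sj m) ⟨
      U n j m - U n (suc j) m
        ∎
      where
      open ≡-Reasoning
      distribute : ∀ s x y → s * (x + y) ≡ s * x - - s * y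
      distribute = solve-∀
      1-q^[N+N]P : (1-q^ (N ℕ.+ N) · shift jj P) m ≡ shift jj (1-q^ (a ℕ.+ b) · P) m
      1-q^[N+N]P = trans (cong (λ e → (1-q^ e · shift jj P) m) (sym a+b≡N+N)) (sym (shift-1-q^ jj (a ℕ.+ b) P m))

  thetaSum-extend : ∀ n m → ∑[ j < suc (suc n) ] (weight j * T n j m) ≡ thetaSum n m
  thetaSum-extend n m = begin
    thetaSum n m + weight (suc n) * T n (suc n) m   ≡⟨ cong (λ x → thetaSum n m + weight (suc n) * x) (T-last n m) ⟩
    thetaSum n m + weight (suc n) * + 0             ≡⟨ cong (_+_ (thetaSum n m)) (ℤₚ.*-zeroʳ (weight (suc n))) ⟩
    thetaSum n m + + 0                              ≡⟨ ℤₚ.+-identityʳ (thetaSum n m) ⟩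
    thetaSum n m                                    ∎
    where open ≡-Reasoning

  U-telescope : ∀ n m → ∑[ j < suc (suc n) ] (pairCount j * (U n j m - U n (suc j) m)) ≡ + 0
  U-telescope n m = trans (telescope (λ j → U n j m) (suc n) (U-0+1 n m)) (cong (λ x → - (+ 2 * x)) (U-last n m))

  thetaSum-rec : ∀ n → 1-q^ (suc n ℕ.+ suc n) · thetaSum (suc n) ≗ thetaSum n
  thetaSum-rec n m = begin
    (1-q^ s · thetaSum N) m
      ≡⟨ 1-q^-∑ s (suc N) weight (T N) m ⟩
    ∑[ j < suc N ] (weight j * (1-q^ s · T N j) m)
      ≡⟨ ∑<-cong (suc N) (λ j<N+1 → split (ℕₚ.<⇒≤pred j<N+1)) ⟩
    ∑[ j < suc N ] (weight j * T n j m + pairCount j * (U n j m - U n (suc j) m))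
      ≡⟨ ∑<-+ (suc N) _ _ ⟩
    ∑[ j < suc N ] (weight j * T n j m) + ∑[ j < suc N ] (pairCount j * (U n j m - U n (suc j) m))
      ≡⟨ cong₂ _+_ (thetaSum-extend n m) (U-telescope n m) ⟩
    thetaSum n m + + 0
      ≡⟨ ℤₚ.+-identityʳ (thetaSum n m) ⟩
    thetaSum n m
      ∎
    where
    open ≡-Reasoning
    N s : ℕ
    N = suc n
    s = N ℕ.+ N
    regroup : ∀ w σ x y → w * σ * x ≡ w * σ * y + w * (σ * (x - y))
    regroup = solve-∀
    split : ∀ {j} → j ≤ N → weight j * (1-q^ s · T N j) m ≡ weight j * T n j m + pairCount j * (U n j m - U n (suc j) m)
    split {j} j≤N = trans (regroup (pairCount j) (-1^ j) _ _)
                          (cong (λ x → weight j * T n j m + pairCount j * x) (T-step n j j≤N m))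

  thetaSum-0 : thetaSum 0 ≗ dilate (F 1)
  thetaSum-0 m = begin
    + 0 + + 1 * (F 1 *ₛ F 1) m    ≡⟨ trans (ℤₚ.+-identityˡ _) (ℤₚ.*-identityˡ _) ⟩
    (F 1 *ₛ F 1) m                ≡⟨ *ₛ-cong F-1 F-1 m ⟩
    (1ₛ *ₛ 1ₛ) m                  ≡⟨ *ₛ-identityˡ 1ₛ m ⟩
    1ₛ m                          ≡⟨ dilate-1ₛ m ⟨
    dilate 1ₛ m                   ≡⟨ dilate-cong F-1 m ⟨
    dilate (F 1) m                ∎
    where open ≡-Reasoning

  thetaSum≗dilate : ∀ n → thetaSum n ≗ dilate (F (suc n))
  thetaSum≗dilate zero    = thetaSum-0
  thetaSum≗dilate (suc n) = 1-q^-cancel (n ℕ.+ suc n) λ m → begin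
    (1-q^ (N ℕ.+ N) · thetaSum N) m                 ≡⟨ thetaSum-rec n m ⟩
    thetaSum n m                                    ≡⟨ thetaSum≗dilate n m ⟩
    dilate (F N) m                                  ≡⟨ dilate-cong (F-rec N) m ⟨
    dilate (1-q^ N · F (suc N)) m                   ≡⟨ 1-q^-dilate N (F (suc N)) m ⟨
    (1-q^ (N ℕ.+ N) · dilate (F (suc N))) m         ∎
    where
    open ≡-Reasoning
    N : ℕ
    N = suc n

-- Partitions with bounded parts

card-⊎ : ∀ {A B : Set} {a b} → A ↔ Fin a → B ↔ Fin b → (A ⊎ B) ↔ Fin (a ℕ.+ b)
card-⊎ A↔a B↔b = ↔-trans (A↔a ⊎-↔ B↔b) (↔-sym +↔⊎)

card-× : ∀ {A B : Set} {a b} → A ↔ Fin a → B ↔ Fin b → (A × B) ↔ Fin (a ℕ.* b)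
card-× A↔a B↔b = ↔-trans (A↔a ×-↔ B↔b) (↔-sym *↔×)

card-unique : ∀ {A : Set} {a b} → A ↔ Fin a → A ↔ Fin b → a ≡ b
card-unique A↔a A↔b = ↔⇒≡ (↔-trans (↔-sym A↔a) A↔b)

shiftℕ : ℕ → (ℕ → ℕ) → ℕ → ℕ
shiftℕ zero    c m       = c m
shiftℕ (suc s) c zero    = 0
shiftℕ (suc s) c (suc m) = shiftℕ s c m

_*ℕ_ : (ℕ → ℕ) → (ℕ → ℕ) → ℕ → ℕ
(α *ℕ β) zero    = α 0 ℕ.* β 0
(α *ℕ β) (suc m) = α 0 ℕ.* β (suc m) ℕ.+ ((λ i → α (suc i)) *ℕ β) m

+-shiftℕ : ∀ s (c : ℕ → ℕ) → shift s (+_ ∘ c) ≗ +_ ∘ shiftℕ s c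
+-shiftℕ zero    c m       = refl
+-shiftℕ (suc s) c zero    = refl
+-shiftℕ (suc s) c (suc m) = +-shiftℕ s c m

+-*ℕ : ∀ (α β : ℕ → ℕ) → (+_ ∘ α) *ₛ (+_ ∘ β) ≗ +_ ∘ (α *ℕ β)
+-*ℕ α β zero    = sym (ℤₚ.pos-* (α 0) (β 0))
+-*ℕ α β (suc m) = begin
  + α 0 * + β (suc m) + ((+_ ∘ α ∘ suc) *ₛ (+_ ∘ β)) m
    ≡⟨ cong₂ _+_ (sym (ℤₚ.pos-* (α 0) (β (suc m)))) (+-*ℕ (α ∘ suc) β m) ⟩
  + (α 0 ℕ.* β (suc m)) + + ((α ∘ suc) *ℕ β) m
    ≡⟨ ℤₚ.pos-+ (α 0 ℕ.* β (suc m)) _ ⟨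
  + (α *ℕ β) (suc m)
    ∎
  where open ≡-Reasoning

Shifted : ℕ → (ℕ → Set) → ℕ → Set
Shifted s X m = Σ[ r ∈ ℕ ] (s ℕ.+ r ≡ m × X r)

Convolution : (ℕ → Set) → (ℕ → Set) → ℕ → Set
Convolution A B m = Σ[ a ∈ ℕ ] Σ[ b ∈ ℕ ] (A a × B b × a ℕ.+ b ≡ m)

card-Shifted : ∀ s m (X : ℕ → Set) (c : ℕ → ℕ) → (∀ r → s ℕ.+ r ≡ m → X r ↔ Fin (c r)) →
               Shifted s X m ↔ Fin (shiftℕ s c m)
card-Shifted zero m X c X↔c = ↔-trans Shifted-0 (X↔c m refl)
  where
  Shifted-0 : Shifted 0 X m ↔ X m
  Shifted-0 = mk↔ₛ′ (λ { (r , refl , x) → x }) (λ x → m , refl , x) (λ _ → refl) (λ { (r , refl , x) → refl })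
card-Shifted (suc s) zero X c X↔c = ↔-trans Shifted-empty (↔-sym 0↔⊥)
  where
  Shifted-empty : Shifted (suc s) X 0 ↔ ⊥
  Shifted-empty = mk↔ₛ′ (λ { (r , () , x) }) (λ ()) (λ ()) (λ { (r , () , x) })
card-Shifted (suc s) (suc m) X c X↔c = ↔-trans Shifted-suc (card-Shifted s m X c (λ r e → X↔c r (cong suc e)))
  where
  Shifted-suc : Shifted (suc s) X (suc m) ↔ Shifted s X m
  Shifted-suc = mk↔ₛ′ (λ { (r , e , x) → r , ℕₚ.suc-injective e , x }) (λ { (r , e , x) → r , cong suc e , x })
                      (λ { (r , refl , x) → refl }) (λ { (r , refl , x) → refl })

card-Convolution : ∀ m (A B : ℕ → Set) (α β : ℕ → ℕ) →
                   (∀ a → A a ↔ Fin (α a)) → (∀ b → B b ↔ Fin (β b)) →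
                   Convolution A B m ↔ Fin ((α *ℕ β) m)
card-Convolution zero A B α β A↔α B↔β = ↔-trans Convolution-0 (card-× (A↔α 0) (B↔β 0))
  where
  Convolution-0 : Convolution A B 0 ↔ (A 0 × B 0)
  Convolution-0 = mk↔ₛ′ (λ { (zero , zero , x , y , refl) → x , y }) (λ { (x , y) → 0 , 0 , x , y , refl })
                        (λ _ → refl) (λ { (zero , zero , x , y , refl) → refl })
card-Convolution (suc m) A B α β A↔α B↔β =
  ↔-trans Convolution-suc
    (card-⊎ (card-× (A↔α 0) (B↔β (suc m)))
            (card-Convolution m (A ∘ suc) B (α ∘ suc) β (A↔α ∘ suc) B↔β))
  where
  to : Convolution A B (suc m) → (A 0 × B (suc m)) ⊎ Convolution (λ a → A (suc a)) B m
  to (zero  , b , x , y , refl) = inj₁ (x , y)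
  to (suc a , b , x , y , e)    = inj₂ (a , b , x , y , ℕₚ.suc-injective e)
  from : (A 0 × B (suc m)) ⊎ Convolution (λ a → A (suc a)) B m → Convolution A B (suc m)
  from (inj₁ (x , y))             = 0 , suc m , x , y , refl
  from (inj₂ (a , b , x , y , e)) = suc a , b , x , y , cong suc e
  to∘from : ∀ z → to (from z) ≡ z
  to∘from (inj₁ _)                    = refl
  to∘from (inj₂ (a , b , x , y , refl)) = refl
  from∘to : ∀ z → from (to z) ≡ z
  from∘to (zero  , b , x , y , refl) = refl
  from∘to (suc a , b , x , y , refl) = refl
  Convolution-suc : Convolution A B (suc m) ↔ ((A 0 × B (suc m)) ⊎ Convolution (λ a → A (suc a)) B m)
  Convolution-suc = mk↔ₛ′ to from to∘from from∘to

open Partition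

Partition-≡ : ∀ {m} {π ρ : Partition m} → parts π ≡ parts ρ → π ≡ ρ
Partition-≡ {π = mkPartition xs p l s} {mkPartition .xs p′ l′ s′} refl
  with All.irrelevant ℕₚ.<-irrelevant p p′ | Linked.irrelevant ℕₚ.≤-irrelevant l l′ | ℕₚ.≡-irrelevant s s′
... | refl | refl | refl = refl

BoundedPartition : ℕ → ℕ → Set
BoundedPartition K m = Σ[ π ∈ Partition m ] All (_≤ K) (parts π)

BoundedPartition-≡ : ∀ {K m} {u v : BoundedPartition K m} → parts (proj₁ u) ≡ parts (proj₁ v) → u ≡ v
BoundedPartition-≡ {u = π , b} {ρ , b′} e with Partition-≡ {π = π} {ρ} e
... | refl = cong (π ,_) (All.irrelevant ℕₚ.≤-irrelevant b b′)

part≤sum : ∀ xs → All (_≤ sum xs) xs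
part≤sum []       = []
part≤sum (x ∷ xs) =
  ℕₚ.m≤m+n x (sum xs) ∷ All.map (λ y≤ → ℕₚ.≤-trans y≤ (ℕₚ.m≤n+m (sum xs) x)) (part≤sum xs)

Partition↔BoundedPartition : ∀ {K m} → m ≤ K → Partition m ↔ BoundedPartition K m
Partition↔BoundedPartition {K} {m} m≤K = mk↔ₛ′ bound proj₁ (λ _ → BoundedPartition-≡ refl) (λ _ → refl)
  where
  bound : Partition m → BoundedPartition K m
  bound π = π , All.map (λ x≤ → ℕₚ.≤-trans x≤ (ℕₚ.≤-trans (ℕₚ.≤-reflexive (sumParts π)) m≤K))
                        (part≤sum (parts π))

BoundedPartition-0-0 : BoundedPartition 0 0 ↔ Fin 1
BoundedPartition-0-0 = mk↔ₛ′ (λ _ → Fin.zero) (λ _ → mkPartition [] [] [] refl , [])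
                             (λ { Fin.zero → refl ; (Fin.suc ()) }) (λ u → BoundedPartition-≡ (sym (no-parts u)))
  where
  no-parts : (u : BoundedPartition 0 0) → parts (proj₁ u) ≡ []
  no-parts (mkPartition [] _ _ _ , _)                         = refl
  no-parts (mkPartition (x ∷ xs) (0<x ∷ _) _ _ , (x≤0 ∷ _)) = ⊥-elim (ℕₚ.<⇒≱ 0<x x≤0)

BoundedPartition-0-suc : ∀ m → BoundedPartition 0 (suc m) ↔ Fin 0
BoundedPartition-0-suc m = ↔-trans (mk↔ₛ′ empty (λ ()) (λ ()) (λ u → ⊥-elim (empty u))) (↔-sym 0↔⊥)
  where
  empty : BoundedPartition 0 (suc m) → ⊥
  empty (mkPartition [] _ _ () , _)
  empty (mkPartition (x ∷ xs) (0<x ∷ _) _ _ , (x≤0 ∷ _)) = ℕₚ.<⇒≱ 0<x x≤0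

module _ (K m : ℕ) where
  private
    bounded-by-head : ∀ {x xs} → Linked (λ a b → b ≤ a) (x ∷ xs) → x ≤ K → All (_≤ K) (x ∷ xs)
    bounded-by-head {xs = []}     _         x≤K = x≤K ∷ []
    bounded-by-head {xs = y ∷ ys} (y≤x ∷ l) x≤K = x≤K ∷ bounded-by-head l (ℕₚ.≤-trans y≤x x≤K)

    cons-linked : ∀ {ys} → All (_≤ suc K) ys → Linked (λ a b → b ≤ a) ys → Linked (λ a b → b ≤ a) (suc K ∷ ys)
    cons-linked []      _ = [-]
    cons-linked (y≤ ∷ _) l = y≤ ∷ l

    to : BoundedPartition (suc K) m → BoundedPartition K m ⊎ Shifted (suc K) (BoundedPartition (suc K)) m
    to (mkPartition [] p l s , b) = inj₁ (mkPartition [] p l s , [])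
    to (mkPartition (x ∷ xs) (px ∷ pxs) l s , (x≤ ∷ xs≤)) with x ℕₚ.≟ suc K
    ... | yes refl = inj₂ (sum xs , s , mkPartition xs pxs (Linked.tail l) refl , xs≤)
    ... | no  x≢   =
      inj₁ (mkPartition (x ∷ xs) (px ∷ pxs) l s , bounded-by-head l (ℕ.s≤s⁻¹ (ℕₚ.≤∧≢⇒< x≤ x≢)))

    from : BoundedPartition K m ⊎ Shifted (suc K) (BoundedPartition (suc K)) m → BoundedPartition (suc K) m
    from (inj₁ (π , b)) = π , All.map ℕₚ.m≤n⇒m≤1+n b
    from (inj₂ (r , e , (mkPartition ys pys l refl , ys≤))) =
      mkPartition (suc K ∷ ys) (s≤s z≤n ∷ pys) (cons-linked ys≤ l) e , ℕₚ.≤-refl ∷ ys≤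

    from∘to : ∀ u → from (to u) ≡ u
    from∘to (mkPartition [] p l s , []) = refl
    from∘to (mkPartition (x ∷ xs) (px ∷ pxs) l s , (x≤ ∷ xs≤)) with x ℕₚ.≟ suc K
    ... | yes refl = BoundedPartition-≡ refl
    ... | no  _    = BoundedPartition-≡ refl

    to∘from : ∀ v → to (from v) ≡ v
    to∘from (inj₁ (mkPartition [] p l s , [])) = refl
    to∘from (inj₁ (mkPartition (x ∷ xs) (px ∷ pxs) l s , (x≤ ∷ xs≤))) with x ℕₚ.≟ suc K
    ... | yes refl = ⊥-elim (ℕₚ.<-irrefl refl x≤)
    ... | no  _    = cong inj₁ (BoundedPartition-≡ refl)
    to∘from (inj₂ (r , e , (mkPartition ys pys l refl , ys≤))) with suc K ℕₚ.≟ suc K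
    ... | yes refl = cong (λ l′ → inj₂ (sum ys , e , mkPartition ys pys l′ refl , ys≤))
                          (Linked.irrelevant ℕₚ.≤-irrelevant _ _)
    ... | no  K+1≢K+1 = ⊥-elim (K+1≢K+1 refl)

  BoundedPartition-split : BoundedPartition (suc K) m ↔ (BoundedPartition K m ⊎ Shifted (suc K) (BoundedPartition (suc K)) m)
  BoundedPartition-split = mk↔ₛ′ to from to∘from from∘to

-- The number of partitions of m with parts ≤ K, provided fuel > m; the fuel makes the recursion structural.
fueledCount : (fuel K m : ℕ) → ℕ
fueledCount fuel       zero    zero    = 1
fueledCount fuel       zero    (suc m) = 0
fueledCount zero       (suc K) m       = 0
fueledCount (suc fuel) (suc K) m       = fueledCount (suc fuel) K m ℕ.+ shiftℕ (suc K) (fueledCount fuel (suc K)) m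

fueledCount-correct : ∀ fuel K m → m < fuel → BoundedPartition K m ↔ Fin (fueledCount fuel K m)
fueledCount-correct fuel       zero    zero    _ = BoundedPartition-0-0
fueledCount-correct fuel       zero    (suc m) _ = BoundedPartition-0-suc m
fueledCount-correct (suc fuel) (suc K) m m<fuel =
  ↔-trans (BoundedPartition-split K m)
    (card-⊎ (fueledCount-correct (suc fuel) K m m<fuel)
            (card-Shifted (suc K) m (BoundedPartition (suc K)) (fueledCount fuel (suc K))
                          (λ r e → fueledCount-correct fuel (suc K) r (r<fuel r e))))
  where
  r<fuel : ∀ r → suc K ℕ.+ r ≡ m → r < fuel
  r<fuel r e = ℕₚ.<-≤-trans (ℕₚ.≤-trans (s≤s (ℕₚ.m≤n+m r K)) (ℕₚ.≤-reflexive e)) (ℕ.s≤s⁻¹ m<fuel)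

boundedCount : ℕ → ℕ → ℕ
boundedCount K m = fueledCount (suc m) K m

BoundedPartition↔Fin : ∀ K m → BoundedPartition K m ↔ Fin (boundedCount K m)
BoundedPartition↔Fin K m = fueledCount-correct (suc m) K m ℕₚ.≤-refl

boundedCount-rec : ∀ K m → boundedCount (suc K) m ≡ boundedCount K m ℕ.+ shiftℕ (suc K) (boundedCount (suc K)) m
boundedCount-rec K m = card-unique (BoundedPartition↔Fin (suc K) m)
  (↔-trans (BoundedPartition-split K m)
    (card-⊎ (BoundedPartition↔Fin K m)
            (card-Shifted (suc K) m (BoundedPartition (suc K)) (boundedCount (suc K)) (λ r _ → BoundedPartition↔Fin (suc K) r))))

-- Comparing coefficients

partitionSeries : ℕ → Series
partitionSeries zero    = 0ₛ
partitionSeries (suc K) = +_ ∘ boundedCount K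

partitionSeries-1 : partitionSeries 1 ≗ 1ₛ
partitionSeries-1 zero    = refl
partitionSeries-1 (suc m) = refl

partitionSeries-rec : ∀ K → 1-q^ K · partitionSeries (suc K) ≗ partitionSeries K
partitionSeries-rec zero    m = ℤₚ.+-inverseʳ (+ boundedCount 0 m)
partitionSeries-rec (suc K) m = begin
  + boundedCount (suc K) m - shift (suc K) (+_ ∘ boundedCount (suc K)) m
    ≡⟨ cong₂ _-_ (trans (cong +_ (boundedCount-rec K m)) (ℤₚ.pos-+ (boundedCount K m) _))
                 (+-shiftℕ (suc K) (boundedCount (suc K)) m) ⟩
  (+ boundedCount K m + + shiftℕ (suc K) (boundedCount (suc K)) m) - + shiftℕ (suc K) (boundedCount (suc K)) m
    ≡⟨ cancel (+ boundedCount K m) (+ shiftℕ (suc K) (boundedCount (suc K)) m) ⟩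
  + boundedCount K m
    ∎
  where
  open ≡-Reasoning
  cancel : ∀ a b → (a + b) - b ≡ a
  cancel = solve-∀

open ThetaSum partitionSeries (λ _ → refl) partitionSeries-1 partitionSeries-rec

extℤ-sub-≤ : ∀ f {k n} → k ≤ n → extℤ f (+ n - + k) ≡ + f (n ℕ.∸ k)
extℤ-sub-≤ f {k} {n} k≤n = cong (extℤ f) (trans (ℤₚ.m-n≡m⊖n n k) (ℤₚ.⊖-≥ k≤n))

extℤ-sub-> : ∀ f {k n} → n < k → extℤ f (+ n - + k) ≡ + 0
extℤ-sub-> f {k} {n} n<k =
  trans (cong (extℤ f) (trans (ℤₚ.m-n≡m⊖n n k) (ℤₚ.⊖-< n<k))) (extℤ-neg (ℕₚ.m<n⇒0<n∸m n<k))
  where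
  extℤ-neg : ∀ {d} → 0 < d → extℤ f (- + d) ≡ + 0
  extℤ-neg {suc d} _ = refl

shift≡extℤ : ∀ {k n} (g : Series) f → (k ≤ n → g (n ℕ.∸ k) ≡ + f (n ℕ.∸ k)) →
             shift k g n ≡ extℤ f (+ n - + k)
shift≡extℤ {k} {n} g f agree with k ℕₚ.≤? n
... | yes k≤n = trans (shift-≥ g k≤n) (trans (agree k≤n) (sym (extℤ-sub-≤ f k≤n)))
... | no  k≰n = trans (shift-< g (ℕₚ.≰⇒> k≰n)) (sym (extℤ-sub-> f (ℕₚ.≰⇒> k≰n)))

halfTerm-suc-suc : ∀ g m → halfTerm g (suc (suc m)) ≡ halfTerm (g ∘ suc) m
halfTerm-suc-suc g m with m ℕ.% 2
... | zero  = cong (+_ ∘ g) (m/n≡1+[m∸n]/n {suc (suc m)} {2} (s≤s (s≤s z≤n)))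
... | suc _ = refl

dilate≡halfTerm : ∀ (f : Series) g m → (∀ {i} → i ≤ m → f i ≡ + g i) → dilate f m ≡ halfTerm g m
dilate≡halfTerm f g zero          f≡g = f≡g z≤n
dilate≡halfTerm f g (suc zero)    f≡g = refl
dilate≡halfTerm f g (suc (suc m)) f≡g =
  trans (dilate≡halfTerm (f ∘ suc) (g ∘ suc) m (f≡g ∘ s≤s ∘ ℕₚ.m≤n⇒m≤1+n)) (sym (halfTerm-suc-suc g m))

sgn-suc : ∀ i → sgn (+ suc i) ≡ -1^ i
sgn-suc zero          = refl
sgn-suc (suc zero)    = refl
sgn-suc (suc (suc i)) = trans (sgn-period i) (trans (sgn-suc i) (sym (ℤₚ.neg-involutive (-1^ i))))
  where
  sgn-period : ∀ i → sgn (+ suc (suc (suc i))) ≡ sgn (+ suc i)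
  sgn-period i with suc i ℕ.% 2
  ... | zero  = refl
  ... | suc _ = refl

foldr-pairs : ∀ (f : ℤ → ℤ) (g : ℕ → ℕ) n →
              foldr _+_ (+ 0) (map f (concatMap (λ j → + suc j ∷ - (+ suc j) ∷ []) (applyUpTo g n)))
              ≡ ∑[ i < n ] (f (+ suc (g i)) + f (- (+ suc (g i))))
foldr-pairs f g zero    = refl
foldr-pairs f g (suc n) = begin
  f (+ suc (g 0)) + (f (- (+ suc (g 0))) + foldr _+_ (+ 0) (map f (concatMap _ (applyUpTo (g ∘ suc) n))))
    ≡⟨ ℤₚ.+-assoc (f (+ suc (g 0))) _ _ ⟨
  (f (+ suc (g 0)) + f (- (+ suc (g 0)))) + foldr _+_ (+ 0) (map f (concatMap _ (applyUpTo (g ∘ suc) n)))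
    ≡⟨ cong (_+_ (f (+ suc (g 0)) + f (- (+ suc (g 0))))) (foldr-pairs f (g ∘ suc) n) ⟩
  (f (+ suc (g 0)) + f (- (+ suc (g 0)))) + ∑[ i < n ] (f (+ suc (g (suc i))) + f (- (+ suc (g (suc i)))))
    ≡⟨ ∑<-cons n _ ⟨
  ∑[ i < suc n ] (f (+ suc (g i)) + f (- (+ suc (g i))))
    ∎
  where open ≡-Reasoning

-- The fold inside altSum is local to Defs and cannot be named; Agda infers it for the `_` below.
mutual
  altSum≡foldr : ∀ p n → altSum p n ≡ foldr _+_ (+ 0) (map (λ k → sgn k * extℤ p (+ n - k * k)) (nonzeroRange n))
  altSum≡foldr p n with map (λ k → sgn k * extℤ p (+ n - k * k)) (nonzeroRange n)
  ... | xs = localFold≡foldr p n xs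

  localFold≡foldr : ∀ (p : ℕ → ℕ) n xs → _ ≡ foldr _+_ (+ 0) xs
  localFold≡foldr p n = foldr-universal _ _+_ (+ 0) refl (λ _ _ → refl)

module _ {p p₂ : ℕ → ℕ} (hp : ∀ m → Partition m ↔ Fin (p m)) (hp₂ : ∀ m → Bipartition m ↔ Fin (p₂ m)) where

  partitionSeries≡p : ∀ {K i} → i ≤ K → partitionSeries (suc K) i ≡ + p i
  partitionSeries≡p {K} {i} i≤K =
    cong +_ (card-unique (↔-trans (Partition↔BoundedPartition i≤K) (BoundedPartition↔Fin K i)) (hp i))

  partitionSeries²≡p₂ : ∀ {a b r} → r ≤ a → r ≤ b →
                        (partitionSeries (suc a) *ₛ partitionSeries (suc b)) r ≡ + p₂ r
  partitionSeries²≡p₂ {a} {b} {r} r≤a r≤b = begin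
    (partitionSeries (suc a) *ₛ partitionSeries (suc b)) r
      ≡⟨ *ₛ-cong-≤ r (λ i≤r → partitionSeries≡p (ℕₚ.≤-trans i≤r r≤a))
                     (λ i≤r → partitionSeries≡p (ℕₚ.≤-trans i≤r r≤b)) ⟩
    ((+_ ∘ p) *ₛ (+_ ∘ p)) r
      ≡⟨ +-*ℕ p p r ⟩
    + (p *ℕ p) r
      ≡⟨ cong +_ (card-unique (card-Convolution r Partition Partition p p hp hp) (hp₂ r)) ⟩
    + p₂ r
      ∎
    where open ≡-Reasoning

  T-coefficient : ∀ {n j} → j ≤ n → T n j n ≡ extℤ p₂ (+ n - + (j ℕ.* j))
  T-coefficient {n} {j} j≤n = shift≡extℤ {j ℕ.* j} {n} _ p₂ λ _ →
    trans (*ₛ-cong (λ _ → refl) (F-cong (ℕₚ.+-∸-assoc 1 j≤n)) (n ℕ.∸ j ℕ.* j))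
          (partitionSeries²≡p₂ (ℕₚ.≤-trans (ℕₚ.m∸n≤m n (j ℕ.* j)) (ℕₚ.m≤m+n n j))
                               (ℕₚ.∸-monoʳ-≤ n (j≤j*j j)))
    where
    j≤j*j : ∀ j → j ≤ j ℕ.* j
    j≤j*j zero    = z≤n
    j≤j*j (suc j) = ℕₚ.m≤m*n (suc j) (suc j)

  thetaSum-coefficient : ∀ n → thetaSum n n ≡ + p₂ n - altSum p₂ n
  thetaSum-coefficient n = begin
    thetaSum n n
      ≡⟨ ∑<-cons n _ ⟩
    weight 0 * T n 0 n + ∑[ i < n ] (weight (suc i) * T n (suc i) n)
      ≡⟨ cong₂ _+_ leading (∑<-cong n pair) ⟩
    + p₂ n + ∑[ i < n ] (- (term (+ suc i) + term (- (+ suc i))))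
      ≡⟨ cong (_+_ (+ p₂ n)) (∑<-neg n _) ⟩
    + p₂ n - ∑[ i < n ] (term (+ suc i) + term (- (+ suc i)))
      ≡⟨ cong (_-_ (+ p₂ n)) (trans (altSum≡foldr p₂ n) (foldr-pairs term (λ i → i) n)) ⟨
    + p₂ n - altSum p₂ n
      ∎
    where
    open ≡-Reasoning
    term : ℤ → ℤ
    term k = sgn k * extℤ p₂ (+ n - k * k)
    leading : weight 0 * T n 0 n ≡ + p₂ n
    leading = trans (ℤₚ.*-identityˡ _) (trans (T-coefficient z≤n) (extℤ-sub-≤ p₂ z≤n))
    double : ∀ s v → + 2 * - s * v ≡ - (s * v + s * v)
    double = solve-∀
    pair : ∀ {i} → suc i ≤ n → weight (suc i) * T n (suc i) n ≡ - (term (+ suc i) + term (- (+ suc i)))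
    pair {i} i<n = begin
      + 2 * - -1^ i * T n (suc i) n     ≡⟨ cong (+ 2 * - -1^ i *_) (T-coefficient i<n) ⟩
      + 2 * - -1^ i * V                 ≡⟨ double (-1^ i) V ⟩
      - (-1^ i * V + -1^ i * V)         ≡⟨ cong (λ s → - (s * V + s * V)) (sgn-suc i) ⟨
      - (term (+ suc i) + term (- (+ suc i))) ∎
      where
      V : ℤ
      V = extℤ p₂ (+ n - + (suc i ℕ.* suc i))

  dilate-coefficient : ∀ n → dilate (partitionSeries (suc n)) n ≡ halfTerm p n
  dilate-coefficient n = dilate≡halfTerm _ p n partitionSeries≡p

theorem1p1 : (p p₂ : ℕ → ℕ)
    → (∀ m → Partition m ↔ Fin (p m))
    → (∀ m → Bipartition m ↔ Fin (p₂ m))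
    → ∀ n → + p₂ n ≡ halfTerm p n + altSum p₂ n
theorem1p1 p p₂ hp hp₂ n = begin
  + p₂ n                                      ≡⟨ unsplit (+ p₂ n) (altSum p₂ n) ⟩
  (+ p₂ n - altSum p₂ n) + altSum p₂ n        ≡⟨ cong (_+ altSum p₂ n) p₂-altSum≡halfTerm ⟩
  halfTerm p n + altSum p₂ n                  ∎
  where
  open ≡-Reasoning
  unsplit : ∀ x y → x ≡ (x - y) + y
  unsplit = solve-∀
  p₂-altSum≡halfTerm : + p₂ n - altSum p₂ n ≡ halfTerm p n
  p₂-altSum≡halfTerm = begin
    + p₂ n - altSum p₂ n                ≡⟨ thetaSum-coefficient hp hp₂ n ⟨
    thetaSum n n                        ≡⟨ thetaSum≗dilate n n ⟩
    dilate (partitionSeries (suc n)) n  ≡⟨ dilate-coefficient hp hp₂ n ⟩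
    halfTerm p n                        ∎
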